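{- Let $n\ge 6$, $i\in[n-1]$, and let $\overline{\{i\}}=[n-1]\setminus\{i\}$. Then \[\max\{d_\ell(\sigma,\rho):\sigma,\rho\in\mathcal{D}(\overline{\{i\}};n),\ \sigma\ne\rho\}=\begin{cases} n-2 & \text{for } i=1 \text{ or } i=n-1,\\ n-i & \text{for } i=2,3,\ldots,\lfloor n/2\rfloor,\\ i & \text{for } i=\lceil n/2\rceil,\lceil n/2\rceil+1,\ldots,n-2.\end{cases}\]
   Context: $S_n$ is the symmetric group on $[n]=\{1,\ldots,n\}$, with permutations in one-line notation $\sigma=\sigma_1\cdots\sigma_n$. The descent set of $\sigma$ is $\mathcal{D}(\sigma)=\{j\in[n-1]:\sigma_j>\sigma_{j+1}\}$, and for $S\subseteq[n-1]$, $\mathcal{D}(S;n)=\{\sigma\in S_n:\mathcal{D}(\sigma)=S\}$. The $\ell_\infty$-metric is $d_\ell(\sigma,\rho)=\max\{|\sigma_j-\rho_j|:1\le j\le n\}$. -}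

module Defs where

open import Data.Nat using (ℕ; suc; _<_; _>_; _≤_; _⊔_; ∣_-_∣)
open import Data.Fin using (Fin; toℕ; fromℕ<)
open import Data.Fin.Permutation using (Permutation′; _⟨$⟩ʳ_)
open import Data.List using (foldr; map; allFin)
open import Data.Product using (Σ; _×_; ∃)
open import Function.Bundles using (_⇔_)
open import Relation.Binary.PropositionalEquality using (_≡_; _≢_)
open import Relation.Nullary using (¬_)
open import Data.Nat.Properties using (<-trans; n<1+n)

-- Positions and values
-- are 0-indexed internally (Fin n); the one-line entry σ_j (1-indexed j) is
-- 1 + toℕ (σ ⟨$⟩ʳ (j-1)).  Differences of values are unaffected by the shift.

val : {n : ℕ} → Permutation′ n → (k : ℕ) → k < n → ℕ
val σ k h = toℕ (σ ⟨$⟩ʳ fromℕ< h)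

-- j = suc k (1-indexed, j ∈ [n-1]) is a descent of σ: σ_j > σ_{j+1}
DescentAt : {n : ℕ} → Permutation′ n → (k : ℕ) → suc k < n → Set
DescentAt σ k h = val σ k (<-trans (n<1+n k) h) > val σ (suc k) h

InDComp : (n i : ℕ) → Permutation′ n → Set
InDComp n i σ = (k : ℕ) (h : suc k < n) → DescentAt σ k h ⇔ (suc k ≢ i)

dℓ : {n : ℕ} → Permutation′ n → Permutation′ n → ℕ
dℓ {n} σ ρ = foldr _⊔_ 0 (map (λ j → ∣ toℕ (σ ⟨$⟩ʳ j) - toℕ (ρ ⟨$⟩ʳ j) ∣) (allFin n))

Distinct : {n : ℕ} → Permutation′ n → Permutation′ n → Set
Distinct {n} σ ρ = ¬ ((j : Fin n) → σ ⟨$⟩ʳ j ≡ ρ ⟨$⟩ʳ j)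

IsMaxDist : (n i m : ℕ) → Set
IsMaxDist n i m =
  (Σ (Permutation′ n) λ σ → Σ (Permutation′ n) λ ρ →
     InDComp n i σ × InDComp n i ρ × Distinct σ ρ × dℓ σ ρ ≡ m)
  × ((σ ρ : Permutation′ n) → InDComp n i σ → InDComp n i ρ → Distinct σ ρ → dℓ σ ρ ≤ m)

{-# OPTIONS --safe #-}
module Submission where

-- Along a run of descents j + σ_j cannot increase, so for σ ∈ D([n-1] \ {i}; n) it is
-- squeezed into [i + 1, n + 1] on the first run (positions 1..i) and into
-- [n + 1, n + i + 1] on the second.  Two such permutations therefore differ by at most
-- n - i on the first run and at most i on the second; for i = 1 (resp. i = n - 1) the
-- ascent also forces σ_1 ≤ n - 1 (resp. σ_n ≥ 2), lowering the bound at that position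
-- to n - 2.  The maximum is attained by i, ..., 1, n, ..., i + 1 against
-- n, i, ..., 2, n - 1, ..., i + 1, 1 at the first and the last position, and for i = 1
-- (resp. i = n - 1) by 1, n, ..., 2 against n - 1, n, n - 2, ..., 1 (resp. their
-- reverse-complements) at the first (resp. last) position.

open import Data.Fin using (Fin; toℕ; fromℕ<)
open import Data.Fin.Permutation using (Permutation′; _⟨$⟩ʳ_; permutation)
open import Data.Fin.Properties using (toℕ-fromℕ<; fromℕ<-toℕ; toℕ<n; toℕ-injective)
open import Data.List using (map; allFin)
open import Data.List.Membership.Propositional.Properties using (∈-allFin)
open import Data.List.Properties using (foldr-preservesᵇ; foldr-forcesᵇ)
open import Data.List.Relation.Unary.All using (tabulate; lookup)
open import Data.List.Relation.Unary.All.Properties using (map⁺; map⁻)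
open import Data.Nat using (ℕ; zero; suc; _+_; _∸_; _⊔_; _≤_; _<_; _≤′_; ≤′-refl; ≤′-step; ∣_-_∣; z≤n; s≤s; s≤s⁻¹; _<?_; _≤?_; ⌊_/2⌋; ⌈_/2⌉)
open import Data.Nat.Properties
open import Data.Product using (_×_; _,_)
open import Data.Sum using (_⊎_; inj₁; inj₂; [_,_]′)
open import Function using (_∘_)
open import Function.Bundles using (_⇔_; mk⇔; Equivalence; Injection)
open import Function.Properties.Inverse using (↔⇒↣)
open import Relation.Binary.PropositionalEquality using (_≡_; _≢_; refl; sym; trans; cong; cong₂; subst; subst₂; module ≡-Reasoning)
open import Relation.Nullary using (yes; no; contradiction)

open import Defs

MapsInto : ℕ → (ℕ → ℕ) → Set
MapsInto n f = ∀ {k} → k < n → f k < n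

Represents : {n : ℕ} → Permutation′ n → (ℕ → ℕ) → Set
Represents {n} σ f = ∀ {k} (k<n : k < n) → val σ k k<n ≡ f k

record Bijection (n : ℕ) (f : ℕ → ℕ) : Set where
  field
    inverse       : ℕ → ℕ
    maps          : MapsInto n f
    inverse-maps  : MapsInto n inverse
    left-inverse  : ∀ {k} → k < n → inverse (f k) ≡ k
    right-inverse : ∀ {k} → k < n → f (inverse k) ≡ k

inverseBijection : ∀ {n f} (b : Bijection n f) → Bijection n (Bijection.inverse b)
inverseBijection {f = f} b = record
  { inverse = f ; maps = inverse-maps ; inverse-maps = maps
  ; left-inverse = right-inverse ; right-inverse = left-inverse }
  where open Bijection b

involution : ∀ {n f} → MapsInto n f → (∀ {k} → k < n → f (f k) ≡ k) → Bijection n f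
involution {f = f} maps f∘f≡id = record
  { inverse = f ; maps = maps ; inverse-maps = maps
  ; left-inverse = f∘f≡id ; right-inverse = f∘f≡id }

restrict : ∀ {n f} → MapsInto n f → Fin n → Fin n
restrict maps x = fromℕ< (maps (toℕ<n x))

toℕ-restrict : ∀ {n f} (maps : MapsInto n f) x → toℕ (restrict maps x) ≡ f (toℕ x)
toℕ-restrict maps x = toℕ-fromℕ< _

restrict-inverse : ∀ {n f g} (f-maps : MapsInto n f) (g-maps : MapsInto n g) →
                   (∀ {k} → k < n → f (g k) ≡ k) → ∀ x → restrict f-maps (restrict g-maps x) ≡ x
restrict-inverse {f = f} {g} f-maps g-maps f∘g≡id x = toℕ-injective (begin
  toℕ (restrict f-maps (restrict g-maps x)) ≡⟨ toℕ-restrict f-maps _ ⟩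
  f (toℕ (restrict g-maps x))               ≡⟨ cong f (toℕ-restrict g-maps x) ⟩
  f (g (toℕ x))                             ≡⟨ f∘g≡id (toℕ<n x) ⟩
  toℕ x                                     ∎)
  where open ≡-Reasoning

toPermutation : ∀ {n f} → Bijection n f → Permutation′ n
toPermutation b = permutation (restrict maps) (restrict inverse-maps)
  (restrict-inverse maps inverse-maps right-inverse) (restrict-inverse inverse-maps maps left-inverse)
  where open Bijection b

toPermutation-represents : ∀ {n f} (b : Bijection n f) → Represents (toPermutation b) f
toPermutation-represents {f = f} b k<n =
  trans (toℕ-restrict (Bijection.maps b) (fromℕ< k<n)) (cong f (toℕ-fromℕ< k<n))

toFunction : ∀ {n} → Permutation′ n → ℕ → ℕ
toFunction {n} σ k with k <? n
... | yes k<n = toℕ (σ ⟨$⟩ʳ fromℕ< k<n)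
... | no _    = 0

toFunction-represents : ∀ {n} (σ : Permutation′ n) → Represents σ (toFunction σ)
toFunction-represents {n} σ {k} k<n with k <? n
... | yes k<n′ = cong (val σ k) (<-irrelevant k<n k<n′)
... | no k≮n   = contradiction k<n k≮n

represents-injective : ∀ {n} (σ : Permutation′ n) {f} → Represents σ f →
                       ∀ {k l} (k<n : k < n) (l<n : l < n) → f k ≡ f l → k ≡ l
represents-injective σ rep {k} {l} k<n l<n fk≡fl = begin
  k                       ≡⟨ sym (toℕ-fromℕ< k<n) ⟩
  toℕ (fromℕ< k<n)        ≡⟨ cong toℕ (Injection.injective (↔⇒↣ σ) σk≡σl) ⟩
  toℕ (fromℕ< l<n)        ≡⟨ toℕ-fromℕ< l<n ⟩
  l                       ∎
  where
  open ≡-Reasoning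
  σk≡σl : σ ⟨$⟩ʳ fromℕ< k<n ≡ σ ⟨$⟩ʳ fromℕ< l<n
  σk≡σl = toℕ-injective (trans (rep k<n) (trans fk≡fl (sym (rep l<n))))

-- 0-indexed one-line form of an element of D([n-1] \ {i}; n): the only ascent is
-- from position i - 1 to position i.
record DescentsExcept (n i : ℕ) (f : ℕ → ℕ) : Set where
  field
    bounded : MapsInto n f
    descent : ∀ {k} → suc k < n → suc k ≢ i → f (suc k) < f k
    ascent  : ∀ {k} → suc k < n → suc k ≡ i → f k < f (suc k)

module _ {n} (σ : Permutation′ n) {f} (rep : Represents σ f) where

  descentAt⇔ : ∀ {k} (h : suc k < n) → DescentAt σ k h ⇔ f (suc k) < f k
  descentAt⇔ {k} h = mk⇔ (subst₂ _<_ (rep h) (rep k<n))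
                         (subst₂ _<_ (sym (rep h)) (sym (rep k<n)))
    where k<n = <-trans (n<1+n k) h

  InDComp⇒DescentsExcept : ∀ {i} → InDComp n i σ → DescentsExcept n i f
  InDComp⇒DescentsExcept {i} D = record { bounded = bounded ; descent = descent ; ascent = ascent }
    where
    open Equivalence
    bounded : MapsInto n f
    bounded k<n = subst (_< n) (rep k<n) (toℕ<n _)
    descent : ∀ {k} → suc k < n → suc k ≢ i → f (suc k) < f k
    descent {k} h k≢i = to (descentAt⇔ h) (from (D k h) k≢i)
    ascent : ∀ {k} → suc k < n → suc k ≡ i → f k < f (suc k)
    ascent {k} h k≡i = ≤∧≢⇒< (≮⇒≥ (λ desc → to (D k h) (from (descentAt⇔ h) desc) k≡i))
      (λ fk≡fsk → <⇒≢ (n<1+n k) (represents-injective σ rep (<-trans (n<1+n k) h) h fk≡fsk))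

  DescentsExcept⇒InDComp : ∀ {i} → DescentsExcept n i f → InDComp n i σ
  DescentsExcept⇒InDComp D k h = mk⇔
    (λ desc k≡i → <-asym (Equivalence.to (descentAt⇔ h) desc) (ascent h k≡i))
    (λ k≢i → Equivalence.from (descentAt⇔ h) (descent h k≢i))
    where open DescentsExcept D

gap : ∀ {n} → Permutation′ n → Permutation′ n → Fin n → ℕ
gap σ ρ j = ∣ toℕ (σ ⟨$⟩ʳ j) - toℕ (ρ ⟨$⟩ʳ j) ∣

gap≤dℓ : ∀ {n} (σ ρ : Permutation′ n) j → gap σ ρ j ≤ dℓ σ ρ
gap≤dℓ {n} σ ρ j =
  lookup (map⁻ (foldr-forcesᵇ {P = _≤ dℓ σ ρ} ⊔≤-split 0 (map (gap σ ρ) (allFin n)) ≤-refl)) (∈-allFin j)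
  where
  ⊔≤-split : ∀ x y → x ⊔ y ≤ dℓ σ ρ → x ≤ dℓ σ ρ × y ≤ dℓ σ ρ
  ⊔≤-split x y x⊔y≤ = m⊔n≤o⇒m≤o x y x⊔y≤ , m⊔n≤o⇒n≤o x y x⊔y≤

dℓ≤ : ∀ {n} (σ ρ : Permutation′ n) {m} → (∀ j → gap σ ρ j ≤ m) → dℓ σ ρ ≤ m
dℓ≤ {n} σ ρ {m} gap≤m =
  foldr-preservesᵇ {P = _≤ m} ⊔-lub {xs = map (gap σ ρ) (allFin n)} z≤n
    (map⁺ (tabulate (λ {j} _ → gap≤m j)))

PointwiseBound : ℕ → ℕ → ℕ → Set
PointwiseBound n i m =
  ∀ {f g} → DescentsExcept n i f → DescentsExcept n i g → ∀ {k} → k < n → ∣ f k - g k ∣ ≤ m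

dℓ≤-pointwiseBound : ∀ {n i m} → PointwiseBound n i m →
                     ∀ σ ρ → InDComp n i σ → InDComp n i ρ → dℓ σ ρ ≤ m
dℓ≤-pointwiseBound {m = m} bound σ ρ Dσ Dρ = dℓ≤ σ ρ gap≤m
  where
  rσ = toFunction-represents σ
  rρ = toFunction-represents ρ
  gap≤m : ∀ j → gap σ ρ j ≤ m
  gap≤m j = subst (λ x → gap σ ρ x ≤ m) (fromℕ<-toℕ j j<n)
    (subst (_≤ m) (sym (cong₂ ∣_-_∣ (rσ j<n) (rρ j<n)))
      (bound (InDComp⇒DescentsExcept σ rσ Dσ) (InDComp⇒DescentsExcept ρ rρ Dρ) j<n))
    where j<n = toℕ<n j

isMaxDist : ∀ {n i m f g p} → PointwiseBound n i m → Bijection n f → Bijection n g →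
            DescentsExcept n i f → DescentsExcept n i g → p < n → ∣ f p - g p ∣ ≡ m → 0 < m →
            IsMaxDist n i m
isMaxDist {m = m} {f} {g} {p} bound bf bg Df Dg p<n gap≡m 0<m =
  (σ , ρ , Dσ , Dρ , distinct , ≤-antisym (dℓ≤-pointwiseBound bound σ ρ Dσ Dρ) lower) ,
  (λ σ′ ρ′ Dσ′ Dρ′ _ → dℓ≤-pointwiseBound bound σ′ ρ′ Dσ′ Dρ′)
  where
  σ = toPermutation bf
  ρ = toPermutation bg
  rσ = toPermutation-represents bf
  rρ = toPermutation-represents bg
  Dσ = DescentsExcept⇒InDComp σ rσ Df
  Dρ = DescentsExcept⇒InDComp ρ rρ Dg
  lower : m ≤ dℓ σ ρ
  lower = subst (_≤ dℓ σ ρ) (trans (cong₂ ∣_-_∣ (rσ p<n) (rρ p<n)) gap≡m)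
                (gap≤dℓ σ ρ (fromℕ< p<n))
  distinct : Distinct σ ρ
  distinct σ≗ρ = <⇒≢ 0<m (sym (begin
    m               ≡⟨ sym gap≡m ⟩
    ∣ f p - g p ∣   ≡⟨ cong (∣ f p -_∣) (sym fp≡gp) ⟩
    ∣ f p - f p ∣   ≡⟨ ∣n-n∣≡0 (f p) ⟩
    0               ∎))
    where
    fp≡gp : f p ≡ g p
    fp≡gp = trans (sym (rσ p<n)) (trans (cong toℕ (σ≗ρ (fromℕ< p<n))) (rρ p<n))
    open ≡-Reasoning

index+value-antitone : ∀ (f : ℕ → ℕ) {a b} → a ≤ b → (∀ {j} → a ≤ j → j < b → f (suc j) < f j) →
                       b + f b ≤ a + f a
index+value-antitone f {a} a≤b = go (≤⇒≤′ a≤b)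
  where
  go : ∀ {b} → a ≤′ b → (∀ {j} → a ≤ j → j < b → f (suc j) < f j) → b + f b ≤ a + f a
  go ≤′-refl _ = ≤-refl
  go {suc b} (≤′-step a≤′b) desc = begin
    suc b + f (suc b)    ≡⟨ +-suc b (f (suc b)) ⟨
    b + suc (f (suc b))  ≤⟨ +-monoʳ-≤ b (desc (≤′⇒≤ a≤′b) (n<1+n b)) ⟩
    b + f b              ≤⟨ go a≤′b (λ a≤j j<b → desc a≤j (m<n⇒m<1+n j<b)) ⟩
    a + f a              ∎
    where open ≤-Reasoning

firstRun-window : ∀ {n i f} → DescentsExcept n (suc i) f → suc i ≤ n → ∀ {k} → k ≤ i →
                  suc i ≤ suc k + f k × suc k + f k ≤ n
firstRun-window {n} {i} {f} D i<n {k} k≤i =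
  s≤s (≤-trans (m≤m+n i (f i)) (index+value-antitone f k≤i (λ _ j<i → descent′ j<i))) ,
  ≤-trans (s≤s (index+value-antitone f z≤n (λ _ j<k → descent′ (<-≤-trans j<k k≤i))))
          (bounded (≤-<-trans z≤n k<n))
  where
  open DescentsExcept D
  k<n : k < n
  k<n = <-≤-trans (s≤s k≤i) i<n
  descent′ : ∀ {j} → j < i → f (suc j) < f j
  descent′ j<i = descent (<-≤-trans (s≤s j<i) i<n) (<⇒≢ (s≤s j<i))

lastRun-window : ∀ {n i f} → DescentsExcept (suc n) i f → ∀ {k} → i ≤ k → k ≤ n →
                 suc n ≤ suc k + f k × suc k + f k ≤ i + suc n
lastRun-window {n} {i} {f} D {k} i≤k k≤n =
  s≤s (≤-trans (m≤m+n n (f n)) (index+value-antitone f k≤n (λ k≤j j<n → descent′ (≤-trans i≤k k≤j) j<n))) ,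
  ≤-<-trans (index+value-antitone f i≤k (λ i≤j j<k → descent′ i≤j (<-≤-trans j<k k≤n)))
            (+-monoʳ-< i (bounded i<sn))
  where
  open DescentsExcept D
  i<sn : i < suc n
  i<sn = s≤s (≤-trans i≤k k≤n)
  descent′ : ∀ {j} → i ≤ j → j < n → f (suc j) < f j
  descent′ i≤j j<n = descent (s≤s j<n) (>⇒≢ (s≤s i≤j))

∣-∣≤∸ : ∀ {L U x y} → L ≤ x → x ≤ U → L ≤ y → y ≤ U → ∣ x - y ∣ ≤ U ∸ L
∣-∣≤∸ {x = x} {y} L≤x x≤U L≤y y≤U with ≤-total x y
... | inj₁ x≤y = subst (_≤ _) (sym (m≤n⇒∣m-n∣≡n∸m x≤y)) (∸-mono y≤U L≤x)
... | inj₂ y≤x = subst (_≤ _) (sym (m≤n⇒∣n-m∣≡n∸m y≤x)) (∸-mono x≤U L≤y)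

∣-∣≤width : ∀ {L U} a {x y} → L ≤ a + x × a + x ≤ U → L ≤ a + y × a + y ≤ U → ∣ x - y ∣ ≤ U ∸ L
∣-∣≤width a {x} {y} (L≤a+x , a+x≤U) (L≤a+y , a+y≤U) =
  subst (_≤ _) (∣m+n-m+o∣≡∣n-o∣ a x y) (∣-∣≤∸ L≤a+x a+x≤U L≤a+y a+y≤U)

firstRun-gap : ∀ {n i f g} → DescentsExcept n (suc i) f → DescentsExcept n (suc i) g → suc i ≤ n →
               ∀ {k} → k ≤ i → ∣ f k - g k ∣ ≤ n ∸ suc i
firstRun-gap Df Dg i<n {k} k≤i = ∣-∣≤width (suc k) (firstRun-window Df i<n k≤i) (firstRun-window Dg i<n k≤i)

lastRun-gap : ∀ {n i f g} → DescentsExcept (suc n) i f → DescentsExcept (suc n) i g →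
              ∀ {k} → i ≤ k → k ≤ n → ∣ f k - g k ∣ ≤ i
lastRun-gap {n} {i} Df Dg {k} i≤k k≤n = subst (_ ≤_) (m+n∸n≡m i (suc n))
  (∣-∣≤width (suc k) (lastRun-window Df i≤k k≤n) (lastRun-window Dg i≤k k≤n))

pointwiseBound : ∀ {n i} → 1 ≤ i → i < n → PointwiseBound n i ((n ∸ i) ⊔ i)
pointwiseBound {i = zero} () _
pointwiseBound {zero} {suc i} _ ()
pointwiseBound {suc n} {suc i} _ i<n Df Dg {k} k<n with k ≤? i
... | yes k≤i = ≤-trans (firstRun-gap Df Dg (<⇒≤ i<n) k≤i) (m≤m⊔n (n ∸ i) (suc i))
... | no k≰i  = ≤-trans (lastRun-gap Df Dg (≰⇒> k≰i) (s≤s⁻¹ k<n)) (m≤n⊔m (n ∸ i) (suc i))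

beforeAscent< : ∀ {n i f} → DescentsExcept n (suc i) f → suc i < n → suc (f i) < n
beforeAscent< D i<n = ≤-<-trans (ascent i<n refl) (bounded i<n)
  where open DescentsExcept D

afterAscent>0 : ∀ {n i f} → DescentsExcept n (suc i) f → suc i < n → 0 < f (suc i)
afterAscent>0 D i<n = ≤-<-trans z≤n (DescentsExcept.ascent D i<n refl)

firstAscent-pointwiseBound : ∀ {m} → 1 ≤ m → PointwiseBound (2 + m) 1 m
firstAscent-pointwiseBound {m} _ Df Dg {zero} _ = ∣-∣≤∸ z≤n (f0≤m Df) z≤n (f0≤m Dg)
  where
  f0≤m : ∀ {f} → DescentsExcept (2 + m) 1 f → f 0 ≤ m
  f0≤m D = s≤s⁻¹ (s≤s⁻¹ (beforeAscent< D (s≤s (s≤s z≤n))))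
firstAscent-pointwiseBound 1≤m Df Dg {suc k} k<n = ≤-trans (lastRun-gap Df Dg (s≤s z≤n) (s≤s⁻¹ k<n)) 1≤m

lastAscent-pointwiseBound : ∀ {m} → 1 ≤ m → PointwiseBound (2 + m) (1 + m) m
lastAscent-pointwiseBound {m} 1≤m Df Dg {k} k<n with m<1+n⇒m<n∨m≡n k<n
... | inj₁ k<1+m = ≤-trans (firstRun-gap Df Dg (n≤1+n _) (s≤s⁻¹ k<1+m)) (subst (_≤ m) (sym (m+n∸n≡m 1 m)) 1≤m)
... | inj₂ refl  = ∣-∣≤∸ (afterAscent>0 Df ≤-refl) (lastValue≤ Df) (afterAscent>0 Dg ≤-refl) (lastValue≤ Dg)
  where
  lastValue≤ : ∀ {f} → DescentsExcept (2 + m) (1 + m) f → f (suc m) ≤ suc m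
  lastValue≤ D = s≤s⁻¹ (DescentsExcept.bounded D ≤-refl)

reverse : ℕ → ℕ → ℕ
reverse n k = n ∸ suc k

reverse-maps : ∀ {n} → MapsInto n (reverse n)
reverse-maps {suc n} {k} _ = s≤s (m∸n≤m n k)

reverse-involutive : ∀ {n k} → k < n → reverse n (reverse n k) ≡ k
reverse-involutive {suc n} (s≤s k≤n) = m∸[m∸n]≡n k≤n

reverse-antitone : ∀ {n x y} → x < y → y < n → reverse n y < reverse n x
reverse-antitone x<y y<n = ∸-monoʳ-< (s≤s x<y) y<n

i≤reverse[n+i] : ∀ {n i k} → k < n → i ≤ reverse (n + i) k
i≤reverse[n+i] {n} {i} k<n = subst (_≤ reverse (n + i) _) (m+n∸m≡n n i) (∸-monoʳ-≤ (n + i) k<n)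

reverse[n+i]<n : ∀ {n i k} → i ≤ k → k < n → reverse (n + i) k < n
reverse[n+i]<n {suc n} {i} i≤k _ = s≤s (≤-trans (∸-monoʳ-≤ (n + i) i≤k) (≤-reflexive (m+n∸n≡m n i)))

reverseRuns : ℕ → ℕ → ℕ → ℕ
reverseRuns n i k with k <? i
... | yes _ = reverse i k
... | no _  = reverse (n + i) k

reverseRuns-first : ∀ {n i k} → k < i → reverseRuns n i k ≡ reverse i k
reverseRuns-first {n} {i} {k} k<i with k <? i
... | yes _  = refl
... | no k≮i = contradiction k<i k≮i

reverseRuns-last : ∀ {n i k} → i ≤ k → reverseRuns n i k ≡ reverse (n + i) k
reverseRuns-last {n} {i} {k} i≤k with k <? i
... | yes k<i = contradiction i≤k (<⇒≱ k<i)
... | no _    = refl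

reverseRuns-maps : ∀ {n i} → i ≤ n → MapsInto n (reverseRuns n i)
reverseRuns-maps {n} {i} i≤n {k} k<n with k <? i
... | yes k<i = <-≤-trans (reverse-maps k<i) i≤n
... | no k≮i  = reverse[n+i]<n (≮⇒≥ k≮i) k<n

reverseRuns-involutive : ∀ {n i k} → k < n → reverseRuns n i (reverseRuns n i k) ≡ k
reverseRuns-involutive {n} {i} {k} k<n with k <? i
... | yes k<i = trans (reverseRuns-first {n} (reverse-maps k<i)) (reverse-involutive k<i)
... | no _    = trans (reverseRuns-last {n} (i≤reverse[n+i] k<n)) (reverse-involutive (≤-trans k<n (m≤m+n n i)))

reverseRuns-bijection : ∀ {n i} → i ≤ n → Bijection n (reverseRuns n i)
reverseRuns-bijection {n} {i} i≤n = involution (reverseRuns-maps i≤n) (reverseRuns-involutive {n} {i})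

reverseRuns-descentsExcept : ∀ {n i} → i ≤ n → DescentsExcept n i (reverseRuns n i)
reverseRuns-descentsExcept {n} {i} i≤n =
  record { bounded = reverseRuns-maps i≤n ; descent = descent ; ascent = ascent }
  where
  descent : ∀ {k} → suc k < n → suc k ≢ i → reverseRuns n i (suc k) < reverseRuns n i k
  descent {k} 1+k<n 1+k≢i with i ≤? k
  ... | yes i≤k = subst₂ _<_ (sym (reverseRuns-last {n} (≤-trans i≤k (n≤1+n k))))
                             (sym (reverseRuns-last {n} i≤k))
                             (reverse-antitone (n<1+n k) (≤-trans 1+k<n (m≤m+n n i)))
  ... | no i≰k  = subst₂ _<_ (sym (reverseRuns-first {n} 1+k<i))
                             (sym (reverseRuns-first {n} (<-trans (n<1+n k) 1+k<i)))
                             (reverse-antitone (n<1+n k) 1+k<i)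
    where
    1+k<i : suc k < i
    1+k<i = ≤∧≢⇒< (≰⇒> i≰k) 1+k≢i
  ascent : ∀ {k} → suc k < n → suc k ≡ i → reverseRuns n i k < reverseRuns n i (suc k)
  ascent {k} 1+k<n 1+k≡i = <-≤-trans
    (subst (_< i) (sym (reverseRuns-first {n} k<i)) (reverse-maps k<i))
    (subst (i ≤_) (sym (reverseRuns-last {n} (≤-reflexive (sym 1+k≡i)))) (i≤reverse[n+i] 1+k<n))
    where
    k<i : k < i
    k<i = ≤-reflexive 1+k≡i

wrap : ℕ → (ℕ → ℕ) → ℕ → ℕ
wrap m g zero = suc m
wrap m g (suc k) with k <? m
... | yes _ = suc (g k)
... | no _  = 0

wrap-inner : ∀ {m g k} → k < m → wrap m g (suc k) ≡ suc (g k)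
wrap-inner {m} {g} {k} k<m with k <? m
... | yes _  = refl
... | no k≮m = contradiction k<m k≮m

wrap-last : ∀ {m g} → wrap m g (suc m) ≡ 0
wrap-last {m} with m <? m
... | yes m<m = contradiction m<m (<-irrefl refl)
... | no _    = refl

wrap-maps : ∀ {m g} → MapsInto m g → MapsInto (2 + m) (wrap m g)
wrap-maps {m} g-maps {zero} _ = ≤-refl
wrap-maps {m} g-maps {suc k} _ with k <? m
... | yes k<m = s≤s (m<n⇒m<1+n (g-maps k<m))
... | no _    = s≤s z≤n

wrap-involutive : ∀ {m g} → MapsInto m g → (∀ {k} → k < m → g (g k) ≡ k) →
                  ∀ {k} → k < 2 + m → wrap m g (wrap m g k) ≡ k
wrap-involutive {m} {g} g-maps g-involutive {zero} _ = wrap-last {m} {g}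
wrap-involutive {m} {g} g-maps g-involutive {suc k} k<2+m with k <? m
... | yes k<m = trans (wrap-inner (g-maps k<m)) (cong suc (g-involutive k<m))
... | no k≮m  = cong suc (≤-antisym (≮⇒≥ k≮m) (s≤s⁻¹ (s≤s⁻¹ k<2+m)))

wrap-descentsExcept : ∀ {m j g} → 1 ≤ j → j < m → DescentsExcept m j g →
                      DescentsExcept (2 + m) (suc j) (wrap m g)
wrap-descentsExcept {m} {j} {g} 1≤j j<m D =
  record { bounded = wrap-maps bounded ; descent = descent′ ; ascent = ascent′ }
  where
  open DescentsExcept D
  0<m : 0 < m
  0<m = <-≤-trans 1≤j (<⇒≤ j<m)
  descent′ : ∀ {k} → suc k < 2 + m → suc k ≢ suc j → wrap m g (suc k) < wrap m g k
  descent′ {zero} _ _ = subst (_< suc m) (sym (wrap-inner 0<m)) (s≤s (bounded 0<m))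
  descent′ {suc k} 2+k<2+m 2+k≢2+j with suc k <? m
  ... | yes 1+k<m = subst (suc (g (suc k)) <_) (sym (wrap-inner k<m))
                            (s≤s (descent 1+k<m (2+k≢2+j ∘ cong suc)))
    where k<m = s≤s⁻¹ (s≤s⁻¹ 2+k<2+m)
  ... | no _      = subst (0 <_) (sym (wrap-inner (s≤s⁻¹ (s≤s⁻¹ 2+k<2+m)))) (s≤s z≤n)
  ascent′ : ∀ {k} → suc k < 2 + m → suc k ≡ suc j → wrap m g k < wrap m g (suc k)
  ascent′ {zero} _ 1≡1+j = contradiction (suc-injective 1≡1+j) (<⇒≢ 1≤j)
  ascent′ {suc k} _ 2+k≡1+j = subst₂ _<_ (sym (wrap-inner (<-trans (n<1+n k) 1+k<m))) (sym (wrap-inner 1+k<m))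
                                      (s≤s (ascent 1+k<m 1+k≡j))
    where
    1+k≡j = suc-injective 2+k≡1+j
    1+k<m = subst (_< m) (sym 1+k≡j) j<m

swap01 : ℕ → ℕ
swap01 zero            = 1
swap01 (suc zero)      = 0
swap01 k@(suc (suc _)) = k

swap01-involutive : ∀ k → swap01 (swap01 k) ≡ k
swap01-involutive zero          = refl
swap01-involutive (suc zero)    = refl
swap01-involutive (suc (suc _)) = refl

swap01-maps : ∀ {n} → 2 ≤ n → MapsInto n swap01
swap01-maps 2≤n {zero}        _   = 2≤n
swap01-maps 2≤n {suc zero}    _   = <-≤-trans (s≤s z≤n) 2≤n
swap01-maps _   {suc (suc _)} k<n = k<n

swap01-mono-< : ∀ {x y} → 1 ≤ x → x < y → swap01 x < swap01 y
swap01-mono-< {suc zero}    {suc (suc _)} _ _   = s≤s z≤n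
swap01-mono-< {suc (suc _)} {suc (suc _)} _ x<y = x<y
swap01-mono-< {suc zero}    {suc zero}    _ (s≤s ())
swap01-mono-< {suc (suc _)} {suc zero}    _ (s≤s ())

reverse∘swap01-bijection : ∀ {n} → 2 ≤ n → Bijection n (reverse n ∘ swap01)
reverse∘swap01-bijection {n} 2≤n = record
  { inverse       = swap01 ∘ reverse n
  ; maps          = reverse-maps ∘ swap01-maps 2≤n
  ; inverse-maps  = swap01-maps 2≤n ∘ reverse-maps
  ; left-inverse  = λ {k} k<n →
      trans (cong swap01 (reverse-involutive (swap01-maps 2≤n k<n))) (swap01-involutive k)
  ; right-inverse = λ {k} k<n →
      trans (cong (reverse n) (swap01-involutive (reverse n k))) (reverse-involutive k<n)
  }

reverse∘swap01-descentsExcept : ∀ {n} → 2 ≤ n → DescentsExcept n 1 (reverse n ∘ swap01)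
reverse∘swap01-descentsExcept {n} 2≤n =
  record { bounded = Bijection.maps (reverse∘swap01-bijection 2≤n) ; descent = descent ; ascent = ascent }
  where
  descent : ∀ {k} → suc k < n → suc k ≢ 1 → reverse n (swap01 (suc k)) < reverse n (swap01 k)
  descent {zero}        _     1≢1 = contradiction refl 1≢1
  descent {suc zero}    2<n   _   = reverse-antitone (s≤s z≤n) 2<n
  descent {suc (suc k)} k+3<n _   = reverse-antitone (n<1+n (suc (suc k))) k+3<n
  ascent : ∀ {k} → suc k < n → suc k ≡ 1 → reverse n (swap01 k) < reverse n (swap01 (suc k))
  ascent {zero} 1<n _ = reverse-antitone (s≤s z≤n) 1<n

swap01∘reverse-descentsExcept : ∀ {n} → 1 ≤ n → DescentsExcept (suc n) n (swap01 ∘ reverse (suc n))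
swap01∘reverse-descentsExcept {n} 1≤n =
  record { bounded = swap01-maps (s≤s 1≤n) ∘ reverse-maps ; descent = descent ; ascent = ascent }
  where
  descent : ∀ {k} → suc k < suc n → suc k ≢ n → swap01 (reverse (suc n) (suc k)) < swap01 (reverse (suc n) k)
  descent {k} 1+k<1+n 1+k≢n = swap01-mono-< (m<n⇒0<n∸m 1+k<n) (reverse-antitone (n<1+n k) 1+k<1+n)
    where 1+k<n = ≤∧≢⇒< (s≤s⁻¹ 1+k<1+n) 1+k≢n
  ascentAtEnd : ∀ k → swap01 (reverse (2 + k) k) < swap01 (reverse (2 + k) (suc k))
  ascentAtEnd k = subst₂ (λ a b → swap01 a < swap01 b) (sym (m+n∸n≡m 1 k)) (sym (n∸n≡0 k)) (s≤s z≤n)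
  ascent : ∀ {k} → suc k < suc n → suc k ≡ n → swap01 (reverse (suc n) k) < swap01 (reverse (suc n) (suc k))
  ascent {k} _ 1+k≡n =
    subst (λ t → swap01 (reverse (suc t) k) < swap01 (reverse (suc t) (suc k))) 1+k≡n (ascentAtEnd k)

firstAscent-isMaxDist : ∀ {n} → 3 ≤ n → IsMaxDist n 1 (n ∸ 2)
firstAscent-isMaxDist {suc (suc m)} (s≤s (s≤s 1≤m)) =
  isMaxDist {p = 0} (firstAscent-pointwiseBound 1≤m)
    (reverse∘swap01-bijection 2≤n) (reverseRuns-bijection 1≤n)
    (reverse∘swap01-descentsExcept 2≤n) (reverseRuns-descentsExcept 1≤n)
    (s≤s z≤n) (∣-∣-identityʳ m) 1≤m
  where
  2≤n : 2 ≤ 2 + m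
  2≤n = s≤s (s≤s z≤n)
  1≤n : 1 ≤ 2 + m
  1≤n = s≤s z≤n

lastAscent-isMaxDist : ∀ {n} → 3 ≤ n → IsMaxDist n (n ∸ 1) (n ∸ 2)
lastAscent-isMaxDist {suc (suc m)} (s≤s (s≤s 1≤m)) =
  isMaxDist {p = suc m} (lastAscent-pointwiseBound 1≤m)
    (inverseBijection (reverse∘swap01-bijection (s≤s (s≤s z≤n)))) (reverseRuns-bijection i≤n)
    (swap01∘reverse-descentsExcept (s≤s z≤n)) (reverseRuns-descentsExcept i≤n)
    ≤-refl gap≡m 1≤m
  where
  i≤n : 1 + m ≤ 2 + m
  i≤n = n≤1+n (suc m)
  gap≡m : ∣ swap01 (reverse (2 + m) (suc m)) - reverseRuns (2 + m) (suc m) (suc m) ∣ ≡ m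
  gap≡m = cong₂ ∣_-_∣ (cong swap01 (n∸n≡0 m))
                      (trans (reverseRuns-last {2 + m} {suc m} ≤-refl) (m+n∸m≡n (2 + m) (suc m)))

middleAscent-isMaxDist : ∀ {n i} → 2 ≤ i → i ≤ n ∸ 2 → IsMaxDist n i ((n ∸ i) ⊔ i)
middleAscent-isMaxDist {zero}      {suc (suc _)} _ ()
middleAscent-isMaxDist {suc zero}  {suc (suc _)} _ ()
middleAscent-isMaxDist {suc (suc m)} {suc j} (s≤s 1≤j) j<m =
  [ attainedAt (s≤s z≤n) gap₀ , attainedAt (n<1+n (suc m)) gap₁₊ₘ ]′ (⊔-sel (suc m ∸ j) (suc j))
  where
  n = 2 + m
  i = suc j
  M = (n ∸ i) ⊔ i
  ω = wrap m (reverseRuns m j)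
  ω-bijection : Bijection n ω
  ω-bijection = involution (wrap-maps (reverseRuns-maps (<⇒≤ j<m)))
                           (wrap-involutive (reverseRuns-maps (<⇒≤ j<m)) (reverseRuns-involutive {m} {j}))
  attainedAt : ∀ {p d} → p < n → ∣ ω p - reverseRuns n i p ∣ ≡ d → M ≡ d → IsMaxDist n i M
  attainedAt p<n gap≡d M≡d =
    isMaxDist (pointwiseBound (s≤s z≤n) (s≤s (m<n⇒m<1+n j<m)))
      ω-bijection (reverseRuns-bijection (<⇒≤ (s≤s (m<n⇒m<1+n j<m))))
      (wrap-descentsExcept 1≤j j<m (reverseRuns-descentsExcept (<⇒≤ j<m)))
      (reverseRuns-descentsExcept (<⇒≤ (s≤s (m<n⇒m<1+n j<m))))
      p<n (trans gap≡d (sym M≡d)) (<-≤-trans (s≤s z≤n) (m≤n⊔m (n ∸ i) i))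
  gap₀ : ∣ ω 0 - reverseRuns n i 0 ∣ ≡ suc m ∸ j
  gap₀ = trans (cong (∣ suc m -_∣) (reverseRuns-first {n} {i} {0} (s≤s z≤n)))
               (m≤n⇒∣n-m∣≡n∸m (<⇒≤ (m<n⇒m<1+n j<m)))
  gap₁₊ₘ : ∣ ω (suc m) - reverseRuns n i (suc m) ∣ ≡ i
  gap₁₊ₘ = cong₂ ∣_-_∣ (wrap-last {m}) (trans (reverseRuns-last {n} (s≤s (<⇒≤ j<m))) (m+n∸m≡n n i))

corollary5p7 : (n i : ℕ) → 6 ≤ n → 1 ≤ i → i < n →
    ((i ≡ 1 ⊎ i ≡ n ∸ 1) → IsMaxDist n i (n ∸ 2))
    × ((2 ≤ i → i ≤ ⌊ n /2⌋ → IsMaxDist n i (n ∸ i))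
    × (⌈ n /2⌉ ≤ i → i ≤ n ∸ 2 → IsMaxDist n i i))
corollary5p7 n i 6≤n _ _ = ends , lowerHalf , upperHalf
  where
  3≤n : 3 ≤ n
  3≤n = ≤-trans (s≤s (s≤s (s≤s z≤n))) 6≤n
  ends : (i ≡ 1 ⊎ i ≡ n ∸ 1) → IsMaxDist n i (n ∸ 2)
  ends (inj₁ i≡1)   = subst (λ t → IsMaxDist n t (n ∸ 2)) (sym i≡1) (firstAscent-isMaxDist 3≤n)
  ends (inj₂ i≡n-1) = subst (λ t → IsMaxDist n t (n ∸ 2)) (sym i≡n-1) (lastAscent-isMaxDist 3≤n)
  lowerHalf : 2 ≤ i → i ≤ ⌊ n /2⌋ → IsMaxDist n i (n ∸ i)
  lowerHalf 2≤i i≤⌊n/2⌋ = subst (IsMaxDist n i) (m≥n⇒m⊔n≡m i≤n∸i)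
    (middleAscent-isMaxDist 2≤i (≤-trans i≤n∸i (∸-monoʳ-≤ n 2≤i)))
    where
    i≤n∸i : i ≤ n ∸ i
    i≤n∸i = m+n≤o⇒m≤o∸n i (begin
      i + i             ≤⟨ +-mono-≤ i≤⌊n/2⌋ (≤-trans i≤⌊n/2⌋ (⌊n/2⌋≤⌈n/2⌉ n)) ⟩
      ⌊ n /2⌋ + ⌈ n /2⌉ ≡⟨ ⌊n/2⌋+⌈n/2⌉≡n n ⟩
      n                 ∎)
      where open ≤-Reasoning
  upperHalf : ⌈ n /2⌉ ≤ i → i ≤ n ∸ 2 → IsMaxDist n i i
  upperHalf ⌈n/2⌉≤i i≤n∸2 = subst (IsMaxDist n i) (m≤n⇒m⊔n≡n n∸i≤i)
    (middleAscent-isMaxDist (≤-trans (⌈n/2⌉-mono 3≤n) ⌈n/2⌉≤i) i≤n∸2)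
    where
    n∸i≤i : n ∸ i ≤ i
    n∸i≤i = m≤n+o⇒m∸n≤o n i (begin
      n                 ≡⟨ ⌊n/2⌋+⌈n/2⌉≡n n ⟨
      ⌊ n /2⌋ + ⌈ n /2⌉ ≤⟨ +-mono-≤ (≤-trans (⌊n/2⌋≤⌈n/2⌉ n) ⌈n/2⌉≤i) ⌈n/2⌉≤i ⟩
      i + i             ∎)
      where open ≤-Reasoning
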